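{- Let $m\geq 2$ and let $G$ be a graph with $n$ vertices which is a $\mathbb{Z}_m$-graph with labelling given by integers $v_1,\dots,v_n$ (representing residues modulo $m$). Let $d=\gcd(v_1,\dots,v_n)$. If $d\mid m$, then $G$ is also a $\mathbb{Z}_{m/d}$-graph.
   Context: For $m\geq 2$, a graph $G$ is a $\mathbb{Z}_m$-graph if there is an injective map $\lambda:V(G)\to\mathbb{Z}_m$ (a labelling) such that two distinct vertices $u,w$ are adjacent if and only if $\lambda(u)+\lambda(w)\in\lambda(V(G))$ (addition modulo $m$). -}

module Defs where

open import Data.Nat as ℕ using (ℕ; zero; suc)
open import Data.Nat.GCD using (gcd)
open import Data.Fin using (Fin; zero; suc)
open import Data.Integer as ℤ using (ℤ; ∣_∣; +_)
open import Data.Integer.Divisibility as ℤD using ()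
open import Data.Product using (Σ; ∃; _×_)
open import Data.Bool using (Bool; true; false)
open import Relation.Binary.PropositionalEquality using (_≡_)
open import Relation.Nullary using (¬_)
open import Function.Bundles using (_⇔_)

record Graph (n : ℕ) : Set where
  field
    adj   : Fin n → Fin n → Bool
    sym   : ∀ i j → adj i j ≡ adj j i
    irrefl : ∀ i → adj i i ≡ false

open Graph public

_≡_[mod_] : ℤ → ℤ → ℕ → Set
a ≡ b [mod m ] = (+ m) ℤD.∣ (a ℤ.- b)

IsZLabelling : (m : ℕ) {n : ℕ} → Graph n → (Fin n → ℤ) → Set
IsZLabelling m {n} G λ′ =
  (∀ i j → λ′ i ≡ λ′ j [mod m ] → i ≡ j) ×
  (∀ u w → ¬ (u ≡ w) →
     (adj G u w ≡ true) ⇔ (Σ (Fin n) λ k → (λ′ u ℤ.+ λ′ w) ≡ λ′ k [mod m ]))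

IsZGraph : (m : ℕ) {n : ℕ} → Graph n → Set
IsZGraph m {n} G = Σ (Fin n → ℤ) λ λ′ → IsZLabelling m G λ′

gcdAll : {n : ℕ} → (Fin n → ℤ) → ℕ
gcdAll {zero}  v = 0
gcdAll {suc n} v = gcd ∣ v zero ∣ (gcdAll (λ i → v (suc i)))

open import Data.Nat.Divisibility using (_∣_; 0∣⇒≡0)
open import Data.Nat using (NonZero; _≤_; s≤s; z≤n)
open import Data.Nat.Base using (≢-nonZero)
open import Relation.Binary.PropositionalEquality using (subst)

divisorNonZero : {d m : ℕ} → 2 ℕ.≤ m → d ∣ m → NonZero d
divisorNonZero {zero} {.(suc (suc _))} (s≤s (s≤s _)) d∣m with 0∣⇒≡0 d∣m
... | ()
divisorNonZero {suc d} _ _ = _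

{-# OPTIONS --safe #-}
module Submission where

-- Every label is a multiple of d, say v i = w i · d, and m = m′ · d with m′ = m / d.
-- Cancelling the common factor d, x · d ≡ y · d (mod m′ · d) holds iff x ≡ y (mod m′),
-- so w is a Z_{m′}-labelling: injectivity and the adjacency rule for v translate
-- verbatim into those for w.

open import Defs
open import Data.Nat using (ℕ; _≤_; _/_)
open import Data.Nat.Divisibility using (_∣_)
open import Data.Fin using (Fin)
open import Data.Integer using (ℤ)

import Data.Nat as ℕ
import Data.Nat.Divisibility as ℕ
open import Data.Nat.GCD using (gcd[m,n]∣m; gcd[m,n]∣n)
open import Data.Nat.DivMod using (m/n*n≡m)
open import Data.Integer as ℤ using (+_; _*_; _+_; _-_)
open import Data.Integer.Properties using (pos-*; *-distribʳ-+)
import Data.Integer.Divisibility as ℤᵘ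
open import Data.Integer.Divisibility.Signed using (∣ᵤ⇒∣; quotient) renaming (_∣_ to _∣ˢ_)
open import Data.Integer.Tactic.RingSolver using (solve-∀)
open import Data.Fin using (zero; suc)
open import Data.Bool using (true)
open import Relation.Nullary using (¬_)
open import Data.Product using (_,_; Σ; map₂)
open import Function.Base using (_∘_)
open import Function.Bundles using (_⇔_; mk⇔; Equivalence)
open import Relation.Binary.PropositionalEquality using (_≡_; subst; subst₂) renaming (sym to ≡-sym)

gcdAll-∣ : ∀ {n} (v : Fin n → ℤ) (i : Fin n) → gcdAll v ∣ ℤ.∣ v i ∣
gcdAll-∣ v zero    = gcd[m,n]∣m (ℤ.∣ v zero ∣) (gcdAll (v ∘ suc))
gcdAll-∣ v (suc i) = ℕ.∣-trans (gcd[m,n]∣n (ℤ.∣ v zero ∣) (gcdAll (v ∘ suc))) (gcdAll-∣ (v ∘ suc) i)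

*-distribʳ-- : ∀ a b c → a * c - b * c ≡ (a - b) * c
*-distribʳ-- = solve-∀

module _ (m d : ℕ) .{{_ : ℕ.NonZero d}} where

  *-cancelʳ-≡-mod : ∀ a b → (a * + d) ≡ (b * + d) [mod m ℕ.* d ] ⇔ (a ≡ b [mod m ])
  *-cancelʳ-≡-mod a b = mk⇔
    (ℤᵘ.*-cancelʳ-∣ (+ d) {+ m} {a - b} ∘ subst₂ (ℤᵘ._∣_) (pos-* m d) (*-distribʳ-- a b (+ d)))
    (subst₂ (ℤᵘ._∣_) (≡-sym (pos-* m d)) (≡-sym (*-distribʳ-- a b (+ d))) ∘ ℤᵘ.*-monoˡ-∣ (+ d) {+ m} {a - b})

  IsZLabelling-cancel : ∀ {n} {G : Graph n} {v w : Fin n → ℤ} →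
    (∀ i → v i ≡ w i * + d) → IsZLabelling (m ℕ.* d) G v → IsZLabelling m G w
  IsZLabelling-cancel {n} {G} {v} {w} v≡wd (inj , adj⇔) = inj′ , adj⇔′
    where
    label-≡ : ∀ x y → (v x ≡ v y [mod m ℕ.* d ]) ⇔ (w x ≡ w y [mod m ])
    label-≡ x y rewrite v≡wd x | v≡wd y = *-cancelʳ-≡-mod (w x) (w y)

    sum-≡ : ∀ x y z → (v x + v y) ≡ v z [mod m ℕ.* d ] ⇔ (w x + w y) ≡ w z [mod m ]
    sum-≡ x y z
      rewrite v≡wd x | v≡wd y | v≡wd z | ≡-sym (*-distribʳ-+ (+ d) (w x) (w y))
      = *-cancelʳ-≡-mod (w x + w y) (w z)

    inj′ : ∀ i j → w i ≡ w j [mod m ] → i ≡ j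
    inj′ i j = inj i j ∘ Equivalence.from (label-≡ i j)

    adj⇔′ : ∀ u x → ¬ u ≡ x →
      (adj G u x ≡ true) ⇔ Σ (Fin n) (λ k → (w u + w x) ≡ w k [mod m ])
    adj⇔′ u x u≢x = mk⇔
      (map₂ (Equivalence.to (sum-≡ u x _)) ∘ Equivalence.to (adj⇔ u x u≢x))
      (Equivalence.from (adj⇔ u x u≢x) ∘ map₂ (Equivalence.from (sum-≡ u x _)))

mainTheorem10 : (m : ℕ) → (2≤m : 2 ≤ m) → (n : ℕ) → (G : Graph n) → (v : Fin n → ℤ) →
    IsZLabelling m G v → (d∣m : gcdAll v ∣ m) →
    IsZGraph ((m / gcdAll v) {{divisorNonZero 2≤m d∣m}}) G
mainTheorem10 m 2≤m n G v isLabelling d∣m =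
  w , IsZLabelling-cancel (m / d) d {G = G} {v} {w} v≡wd isLabelling′
  where
  d = gcdAll v
  instance
    d≢0 : ℕ.NonZero d
    d≢0 = divisorNonZero 2≤m d∣m

  isLabelling′ : IsZLabelling ((m / d) ℕ.* d) G v
  isLabelling′ = subst (λ M → IsZLabelling M G v) (≡-sym (m/n*n≡m d∣m)) isLabelling

  d∣v : ∀ i → + d ∣ˢ v i
  d∣v i = ∣ᵤ⇒∣ (gcdAll-∣ v i)

  w : Fin n → ℤ
  w i = quotient (d∣v i)

  v≡wd : ∀ i → v i ≡ w i * + d
  v≡wd i = _∣ˢ_.equality (d∣v i)
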